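{- Let $n\ge2$ and $\lambda=(\lambda_1,\dots,\lambda_d)$ positive integers with $\sum_t\lambda_t=n$. For integers $i,j\in\{0,1,\dots,n-2\}$ with $i\ne j$, we have $p(i)\preceq p(j)$ in $P(\lambda)$ if and only if $i<j$ and $p(i)+p(j-i)=p(j)$.
   Context: $\Delta_\lambda=\mathrm{conv}(e_1,\dots,e_d,\lambda)\subset\mathbb{R}^d$ ($e_i$ standard basis vectors), with fundamental parallelepiped $\Pi_\lambda=\{\sum_{i=1}^d\gamma_i(1,e_i)+\gamma_{d+1}(1,\lambda): 0\le\gamma_i<1\}$. The poset $P(\lambda)$ is the set $\Pi_\lambda\cap\mathbb{Z}^{d+1}$ with $\sigma\preceq\mu$ iff $\mu-\sigma\in\Pi_\lambda\cap\mathbb{Z}^{d+1}$. For $0\le b<n-1$, $p(b)=\big((\sum_{t=1}^d\lceil b\lambda_t/(n-1)\rceil)-b,\lceil b\lambda_1/(n-1)\rceil,\dots,\lceil b\lambda_d/(n-1)\rceil\big)$; these are exactly the lattice points of $\Pi_\lambda$, each arising from a unique $b$, and one identifies $b$ with $p(b)$. -}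

module Defs where

open import Data.Nat as ℕ using (ℕ; zero; suc)
open import Data.Nat.DivMod using (_/_)
open import Data.Integer as ℤ using (ℤ; +_)
open import Data.Rational as ℚ using (ℚ; 0ℚ; 1ℚ)
open import Data.Fin using (Fin; zero; suc)
open import Data.Product using (Σ; _×_; ∃)
open import Relation.Binary.PropositionalEquality using (_≡_)

sumℕ : (d : ℕ) → (Fin d → ℕ) → ℕ
sumℕ zero f = 0
sumℕ (suc d) f = f zero ℕ.+ sumℕ d (λ i → f (suc i))

sumℚ : (d : ℕ) → (Fin d → ℚ) → ℚ
sumℚ zero f = 0ℚ
sumℚ (suc d) f = f zero ℚ.+ sumℚ d (λ i → f (suc i))

-- ceiling of a / m for m ≥ 1 (the value for m = 0 is an irrelevant convention)
ceilDiv : ℕ → ℕ → ℕ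
ceilDiv a zero = 0
ceilDiv a (suc k) = (a ℕ.+ k) / suc k

toℚ : ℤ → ℚ
toℚ z = z ℚ./ 1

-- Points of ℤ^{d+1}: coordinate 0 is the first coordinate, coordinate (suc t) is coordinate t+1.
Point : ℕ → Set
Point d = Fin (suc d) → ℤ

-- x ∈ Π_λ ∩ ℤ^{d+1}:  x = Σ_{i} γ_i (1, e_i) + γ_{d+1} (1, λ) with 0 ≤ γ < 1.
-- γ : Fin d → ℚ are γ_1..γ_d, δ is γ_{d+1}.
InΠ : (d : ℕ) → (Fin d → ℕ) → Point d → Set
InΠ d lam x =
  Σ (Fin d → ℚ) λ γ → Σ ℚ λ δ →
    ((i : Fin d) → (0ℚ ℚ.≤ γ i) × (γ i ℚ.< 1ℚ)) ×
    (0ℚ ℚ.≤ δ) × (δ ℚ.< 1ℚ) ×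
    (toℚ (x zero) ≡ sumℚ d γ ℚ.+ δ) ×
    ((t : Fin d) → toℚ (x (suc t)) ≡ γ t ℚ.+ δ ℚ.* toℚ (+ lam t))

_⪯[_]_ : {d : ℕ} → Point d → (Fin d → ℕ) → Point d → Set
_⪯[_]_ {d} σ lam μ = InΠ d lam (λ k → μ k ℤ.- σ k)

p : (d : ℕ) → (Fin d → ℕ) → ℕ → ℕ → Point d
p d lam n b zero = + sumℕ d (λ t → ceilDiv (b ℕ.* lam t) (n ℕ.∸ 1)) ℤ.- + b
p d lam n b (suc t) = + ceilDiv (b ℕ.* lam t) (n ℕ.∸ 1)

_⊕_ : {d : ℕ} → Point d → Point d → Point d
(x ⊕ y) k = x k ℤ.+ y k

_≐_ : {d : ℕ} → Point d → Point d → Set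
_≐_ {d} x y = (k : Fin (suc d)) → x k ≡ y k

-- A lattice point x = Σ γₜ (1, eₜ) + δ (1, λ) of Π_λ is determined by its height
-- b = Σₜ xₜ − x₀ = δ (n − 1): the condition 0 ≤ γₜ < 1 says exactly that xₜ = ⌈b λₜ / (n − 1)⌉,
-- so x = p(b), and 0 ≤ δ < 1 says 0 ≤ b < n − 1; conversely every such p(b) lies in Π_λ.
-- The height is additive and takes the value b on p(b), so p(j) − p(i) ∈ Π_λ forces
-- p(j) − p(i) = p(j − i) with j − i ≥ 0.
module Submission where

open import Defs
open import Data.Nat as ℕ using (ℕ; zero; suc; _≤_; _<_; _∸_; z≤n; s≤s)
import Data.Nat.Properties as ℕP
open import Data.Nat.DivMod using (_%_; m≡m%n+[m/n]*n; m%n<n)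
open import Data.Integer as ℤ using (ℤ; +_; -[1+_])
import Data.Integer.Properties as ℤP
open import Data.Rational as ℚ using (ℚ; 0ℚ; 1ℚ)
import Data.Rational.Properties as ℚP
import Data.Rational.Unnormalised as U
import Data.Rational.Unnormalised.Properties as UP
open import Data.Fin using (Fin; zero; suc)
open import Data.Product using (∃; _×_; _,_; proj₁; proj₂)
open import Data.Empty using (⊥-elim)
open import Function.Bundles using (_⇔_; mk⇔; Equivalence)
import Function.Properties.Equivalence as ⇔
open import Relation.Nullary using (¬_)
open import Relation.Binary.Definitions using (tri<; tri≈; tri>)
open import Relation.Binary.PropositionalEquality
import Data.Integer.Solver as ℤSolver
import Data.Rational.Solver as ℚSolver

toℚᵘ-toℚ : ∀ z → ℚ.toℚᵘ (toℚ z) U.≃ U.mkℚᵘ z 0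
toℚᵘ-toℚ z = ℚP.toℚᵘ-fromℚᵘ (U.mkℚᵘ z 0)

toℚ-+ : ∀ a b → toℚ (a ℤ.+ b) ≡ toℚ a ℚ.+ toℚ b
toℚ-+ a b = ℚP.toℚᵘ-injective (begin-equality
  ℚ.toℚᵘ (toℚ (a ℤ.+ b))            ≃⟨ toℚᵘ-toℚ (a ℤ.+ b) ⟩
  U.mkℚᵘ (a ℤ.+ b) 0                ≃⟨ U.*≡* (solve 2 (λ a b → (a :+ b) :* one := (a :* one :+ b :* one) :* one) refl a b) ⟩
  U.mkℚᵘ a 0 U.+ U.mkℚᵘ b 0         ≃⟨ UP.+-cong (toℚᵘ-toℚ a) (toℚᵘ-toℚ b) ⟨
  ℚ.toℚᵘ (toℚ a) U.+ ℚ.toℚᵘ (toℚ b) ≃⟨ ℚP.toℚᵘ-homo-+ (toℚ a) (toℚ b) ⟨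
  ℚ.toℚᵘ (toℚ a ℚ.+ toℚ b)          ∎)
  where open UP.≤-Reasoning
        open ℤSolver.+-*-Solver
        one = con (+ 1)

toℚ-* : ∀ a b → toℚ (a ℤ.* b) ≡ toℚ a ℚ.* toℚ b
toℚ-* a b = ℚP.toℚᵘ-injective (begin-equality
  ℚ.toℚᵘ (toℚ (a ℤ.* b))            ≃⟨ toℚᵘ-toℚ (a ℤ.* b) ⟩
  U.mkℚᵘ (a ℤ.* b) 0                ≃⟨ UP.≃-refl ⟩
  U.mkℚᵘ a 0 U.* U.mkℚᵘ b 0         ≃⟨ UP.*-cong (toℚᵘ-toℚ a) (toℚᵘ-toℚ b) ⟨
  ℚ.toℚᵘ (toℚ a) U.* ℚ.toℚᵘ (toℚ b) ≃⟨ ℚP.toℚᵘ-homo-* (toℚ a) (toℚ b) ⟨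
  ℚ.toℚᵘ (toℚ a ℚ.* toℚ b)          ∎)
  where open UP.≤-Reasoning

toℚ-neg : ∀ a → toℚ (ℤ.- a) ≡ ℚ.- toℚ a
toℚ-neg a = ℚP.toℚᵘ-injective (begin-equality
  ℚ.toℚᵘ (toℚ (ℤ.- a))   ≃⟨ toℚᵘ-toℚ (ℤ.- a) ⟩
  U.mkℚᵘ (ℤ.- a) 0       ≃⟨ UP.-‿cong (toℚᵘ-toℚ a) ⟨
  U.- ℚ.toℚᵘ (toℚ a)     ≃⟨ ℚP.toℚᵘ-homo‿- (toℚ a) ⟨
  ℚ.toℚᵘ (ℚ.- toℚ a)     ∎)
  where open UP.≤-Reasoning

toℚ-minus : ∀ a b → toℚ (a ℤ.- b) ≡ toℚ a ℚ.- toℚ b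
toℚ-minus a b = trans (toℚ-+ a (ℤ.- b)) (cong (toℚ a ℚ.+_) (toℚ-neg b))

toℚ-mono-≤ : ∀ {a b} → a ℤ.≤ b → toℚ a ℚ.≤ toℚ b
toℚ-mono-≤ {a} {b} a≤b = ℚP.toℚᵘ-cancel-≤
  (UP.≤-respˡ-≃ (UP.≃-sym (toℚᵘ-toℚ a)) (UP.≤-respʳ-≃ (UP.≃-sym (toℚᵘ-toℚ b))
    (U.*≤* (ℤP.*-monoʳ-≤-nonNeg (+ 1) a≤b))))

toℚ-cancel-≤ : ∀ {a b} → toℚ a ℚ.≤ toℚ b → a ℤ.≤ b
toℚ-cancel-≤ {a} {b} h with UP.≤-respˡ-≃ (toℚᵘ-toℚ a) (UP.≤-respʳ-≃ (toℚᵘ-toℚ b) (ℚP.toℚᵘ-mono-≤ h))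
... | U.*≤* q = ℤP.*-cancelʳ-≤-pos a b (+ 1) q

toℚ-mono-< : ∀ {a b} → a ℤ.< b → toℚ a ℚ.< toℚ b
toℚ-mono-< {a} {b} a<b = ℚP.toℚᵘ-cancel-<
  (UP.<-respˡ-≃ (UP.≃-sym (toℚᵘ-toℚ a)) (UP.<-respʳ-≃ (UP.≃-sym (toℚᵘ-toℚ b))
    (U.*<* (ℤP.*-monoʳ-<-pos (+ 1) a<b))))

toℚ-cancel-< : ∀ {a b} → toℚ a ℚ.< toℚ b → a ℤ.< b
toℚ-cancel-< {a} {b} h with UP.<-respˡ-≃ (toℚᵘ-toℚ a) (UP.<-respʳ-≃ (toℚᵘ-toℚ b) (ℚP.toℚᵘ-mono-< h))
... | U.*<* q = ℤP.*-cancelʳ-<-nonNeg (+ 1) q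

sumℚ-cong : ∀ d {f g : Fin d → ℚ} → (∀ t → f t ≡ g t) → sumℚ d f ≡ sumℚ d g
sumℚ-cong zero    f≗g = refl
sumℚ-cong (suc d) f≗g = cong₂ ℚ._+_ (f≗g zero) (sumℚ-cong d (λ t → f≗g (suc t)))

sumℚ-distrib-+ : ∀ d (f g : Fin d → ℚ) → sumℚ d (λ t → f t ℚ.+ g t) ≡ sumℚ d f ℚ.+ sumℚ d g
sumℚ-distrib-+ zero    f g = refl
sumℚ-distrib-+ (suc d) f g = trans
  (cong (f zero ℚ.+ g zero ℚ.+_) (sumℚ-distrib-+ d (λ t → f (suc t)) (λ t → g (suc t))))
  (solve 4 (λ a b c e → (a :+ b) :+ (c :+ e) := (a :+ c) :+ (b :+ e)) refl (f zero) (g zero) _ _)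
  where open ℚSolver.+-*-Solver

*-distribˡ-sumℚ : ∀ d (c : ℚ) (f : Fin d → ℚ) → c ℚ.* sumℚ d f ≡ sumℚ d (λ t → c ℚ.* f t)
*-distribˡ-sumℚ zero    c f = ℚP.*-zeroʳ c
*-distribˡ-sumℚ (suc d) c f = trans (ℚP.*-distribˡ-+ c (f zero) _)
  (cong (c ℚ.* f zero ℚ.+_) (*-distribˡ-sumℚ d c (λ t → f (suc t))))

sumℤ : (d : ℕ) → (Fin d → ℤ) → ℤ
sumℤ zero    f = + 0
sumℤ (suc d) f = f zero ℤ.+ sumℤ d (λ t → f (suc t))

sumℤ-cong : ∀ d {f g : Fin d → ℤ} → (∀ t → f t ≡ g t) → sumℤ d f ≡ sumℤ d g
sumℤ-cong zero    f≗g = refl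
sumℤ-cong (suc d) f≗g = cong₂ ℤ._+_ (f≗g zero) (sumℤ-cong d (λ t → f≗g (suc t)))

sumℤ-distrib-minus : ∀ d (f g : Fin d → ℤ) → sumℤ d (λ t → f t ℤ.- g t) ≡ sumℤ d f ℤ.- sumℤ d g
sumℤ-distrib-minus zero    f g = refl
sumℤ-distrib-minus (suc d) f g = trans
  (cong (λ s → (f zero ℤ.- g zero) ℤ.+ s) (sumℤ-distrib-minus d (λ t → f (suc t)) (λ t → g (suc t))))
  (solve 4 (λ a b c e → (a :- b) :+ (c :- e) := (a :+ c) :- (b :+ e)) refl (f zero) (g zero) _ _)
  where open ℤSolver.+-*-Solver

pos-sumℕ : ∀ d (f : Fin d → ℕ) → + sumℕ d f ≡ sumℤ d (λ t → + f t)
pos-sumℕ zero    f = refl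
pos-sumℕ (suc d) f = trans (ℤP.pos-+ (f zero) _) (cong (λ s → + f zero ℤ.+ s) (pos-sumℕ d (λ t → f (suc t))))

toℚ-sumℤ : ∀ d (f : Fin d → ℤ) → toℚ (sumℤ d f) ≡ sumℚ d (λ t → toℚ (f t))
toℚ-sumℤ zero    f = refl
toℚ-sumℤ (suc d) f = trans (toℚ-+ (f zero) _) (cong (toℚ (f zero) ℚ.+_) (toℚ-sumℤ d (λ t → f (suc t))))

_⊖_ : {d : ℕ} → Point d → Point d → Point d
(x ⊖ y) k = x k ℤ.- y k

⊕-≐⇔⊖-≐ : {d : ℕ} {x y z : Point d} → (x ⊕ y) ≐ z ⇔ (z ⊖ x) ≐ y
⊕-≐⇔⊖-≐ {x = x} {y} {z} = mk⇔
  (λ x⊕y≐z k → trans (cong (ℤ._- x k) (sym (x⊕y≐z k))) (solve 2 (λ a b → (a :+ b) :- a := b) refl (x k) (y k)))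
  (λ z⊖x≐y k → trans (cong (λ s → x k ℤ.+ s) (sym (z⊖x≐y k))) (solve 2 (λ a c → a :+ (c :- a) := c) refl (x k) (z k)))
  where open ℤSolver.+-*-Solver

height : {d : ℕ} → Point d → ℤ
height {d} x = sumℤ d (λ t → x (suc t)) ℤ.- x zero

height-⊖ : {d : ℕ} (x y : Point d) → height (x ⊖ y) ≡ height x ℤ.- height y
height-⊖ {d} x y = trans
  (cong (ℤ._- (x zero ℤ.- y zero)) (sumℤ-distrib-minus d (λ t → x (suc t)) (λ t → y (suc t))))
  (solve 4 (λ sx sy x₀ y₀ → (sx :- sy) :- (x₀ :- y₀) := (sx :- x₀) :- (sy :- y₀)) refl
    (sumℤ d (λ t → x (suc t))) (sumℤ d (λ t → y (suc t))) (x zero) (y zero))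
  where open ℤSolver.+-*-Solver

height-cong : {d : ℕ} {x y : Point d} → x ≐ y → height x ≡ height y
height-cong {d} x≐y = cong₂ ℤ._-_ (sumℤ-cong d (λ t → x≐y (suc t))) (x≐y zero)

≐-by-height : {d : ℕ} {x y : Point d} → (∀ t → x (suc t) ≡ y (suc t)) → height x ≡ height y → x ≐ y
≐-by-height {d} {x} {y} tails hx≡hy zero = begin
  x zero                ≡⟨ solve 2 (λ s a → a := s :- (s :- a)) refl Sx (x zero) ⟩
  Sx ℤ.- height x       ≡⟨ cong₂ ℤ._-_ (sumℤ-cong d tails) hx≡hy ⟩
  Sy ℤ.- height y       ≡⟨ solve 2 (λ s a → s :- (s :- a) := a) refl Sy (y zero) ⟩
  y zero                ∎
  where open ≡-Reasoning
        open ℤSolver.+-*-Solver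
        Sx = sumℤ d (λ t → x (suc t))
        Sy = sumℤ d (λ t → y (suc t))
≐-by-height tails hx≡hy (suc t) = tails t

InΠ-resp-≐ : ∀ {d} {lam : Fin d → ℕ} {x y : Point d} → x ≐ y → InΠ d lam x → InΠ d lam y
InΠ-resp-≐ x≐y (γ , δ , γ-bounds , 0≤δ , δ<1 , e₀ , eₜ) =
  γ , δ , γ-bounds , 0≤δ , δ<1 ,
  trans (cong toℚ (sym (x≐y zero))) e₀ , λ t → trans (cong toℚ (sym (x≐y (suc t)))) (eₜ t)

ceilDiv-lower : ∀ K k → K ≤ ceilDiv K (suc k) ℕ.* suc k
ceilDiv-lower K k = ℕP.+-cancelʳ-≤ k K _ (begin
  K ℕ.+ k                             ≡⟨ m≡m%n+[m/n]*n (K ℕ.+ k) (suc k) ⟩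
  (K ℕ.+ k) % suc k ℕ.+ c ℕ.* suc k   ≤⟨ ℕP.+-monoˡ-≤ (c ℕ.* suc k) (ℕP.<⇒≤pred (m%n<n (K ℕ.+ k) (suc k))) ⟩
  k ℕ.+ c ℕ.* suc k                   ≡⟨ ℕP.+-comm k _ ⟩
  c ℕ.* suc k ℕ.+ k                   ∎)
  where open ℕP.≤-Reasoning
        c = ceilDiv K (suc k)

ceilDiv-upper : ∀ K k → ceilDiv K (suc k) ℕ.* suc k < K ℕ.+ suc k
ceilDiv-upper K k = begin-strict
  c ℕ.* suc k                         ≤⟨ ℕP.m≤n+m _ ((K ℕ.+ k) % suc k) ⟩
  (K ℕ.+ k) % suc k ℕ.+ c ℕ.* suc k   ≡⟨ m≡m%n+[m/n]*n (K ℕ.+ k) (suc k) ⟨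
  K ℕ.+ k                             <⟨ ℕP.+-monoʳ-< K (ℕP.n<1+n k) ⟩
  K ℕ.+ suc k                         ∎
  where open ℕP.≤-Reasoning
        c = ceilDiv K (suc k)

window-≮ : ∀ {K m x y} → K ≤ y ℕ.* m → x ℕ.* m < K ℕ.+ m → ¬ (y < x)
window-≮ {K} {m} {x} {y} K≤ym xm<K+m y<x = ℕP.<-irrefl refl (begin-strict
  K ℕ.+ m       ≤⟨ ℕP.+-monoˡ-≤ m K≤ym ⟩
  y ℕ.* m ℕ.+ m ≡⟨ ℕP.+-comm (y ℕ.* m) m ⟩
  suc y ℕ.* m   ≤⟨ ℕP.*-monoˡ-≤ m y<x ⟩
  x ℕ.* m       <⟨ xm<K+m ⟩
  K ℕ.+ m       ∎)
  where open ℕP.≤-Reasoning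

window-unique : ∀ {K m x y} → K ≤ x ℕ.* m → x ℕ.* m < K ℕ.+ m → K ≤ y ℕ.* m → y ℕ.* m < K ℕ.+ m → x ≡ y
window-unique {x = x} {y} K≤xm xm<K+m K≤ym ym<K+m with ℕP.<-cmp x y
... | tri< x<y _ _ = ⊥-elim (window-≮ K≤xm ym<K+m x<y)
... | tri≈ _ x≡y _ = x≡y
... | tri> _ _ y<x = ⊥-elim (window-≮ K≤ym xm<K+m y<x)

window⇔ceilDiv : ∀ K k (x : ℤ) →
  (+ K ℤ.≤ x ℤ.* + suc k × x ℤ.* + suc k ℤ.< + K ℤ.+ + suc k) ⇔ (x ≡ + ceilDiv K (suc k))
window⇔ceilDiv K k x = mk⇔ (to x) from
  where
  to : ∀ x → (+ K ℤ.≤ x ℤ.* + suc k × x ℤ.* + suc k ℤ.< + K ℤ.+ + suc k) → x ≡ + ceilDiv K (suc k)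
  to (+ x) (lo , hi) = cong +_ (window-unique
    (ℤP.drop‿+≤+ (subst (+ K ℤ.≤_) (sym (ℤP.pos-* x (suc k))) lo))
    (ℤP.drop‿+<+ (subst (ℤ._< + (K ℕ.+ suc k)) (sym (ℤP.pos-* x (suc k))) hi))
    (ceilDiv-lower K k) (ceilDiv-upper K k))
  to -[1+ x ] (() , _)
  from : x ≡ + ceilDiv K (suc k) → (+ K ℤ.≤ x ℤ.* + suc k × x ℤ.* + suc k ℤ.< + K ℤ.+ + suc k)
  from refl = subst (+ K ℤ.≤_) (ℤP.pos-* c (suc k)) (ℤ.+≤+ (ceilDiv-lower K k))
            , subst (ℤ._< + (K ℕ.+ suc k)) (ℤP.pos-* c (suc k)) (ℤ.+<+ (ceilDiv-upper K k))
    where c = ceilDiv K (suc k)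

window-shift : ∀ {a K m : ℤ} → (+ 0 ℤ.≤ a ℤ.- K × a ℤ.- K ℤ.< m) ⇔ (K ℤ.≤ a × a ℤ.< K ℤ.+ m)
window-shift {a} {K} {m} = mk⇔
  (λ (lo , hi) → ℤP.0≤i-j⇒j≤i lo ,
     subst₂ ℤ._<_ (solve 2 (λ a K → (a :- K) :+ K := a) refl a K) (ℤP.+-comm m K) (ℤP.+-monoˡ-< K hi))
  (λ (lo , hi) → ℤP.i≤j⇒0≤j-i lo ,
     subst (a ℤ.- K ℤ.<_) (solve 2 (λ K m → (K :+ m) :- K := m) refl K m) (ℤP.+-monoˡ-< (ℤ.- K) hi))
  where open ℤSolver.+-*-Solver

pos-difference : ∀ {i j b} → + b ≡ + j ℤ.- + i → j ≡ i ℕ.+ b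
pos-difference {i} {j} {b} b≡j-i = ℤP.+-injective (begin
  + j                   ≡⟨ solve 2 (λ i j → j := i :+ (j :- i)) refl (+ i) (+ j) ⟩
  + i ℤ.+ (+ j ℤ.- + i) ≡⟨ cong (λ s → + i ℤ.+ s) b≡j-i ⟨
  + i ℤ.+ + b           ≡⟨ ℤP.pos-+ i b ⟨
  + (i ℕ.+ b)           ∎)
  where open ≡-Reasoning
        open ℤSolver.+-*-Solver

module LatticePoints (d : ℕ) (lam : Fin d → ℕ) (k : ℕ) (sum-lam : sumℕ d lam ≡ suc (suc k)) where

  m : ℕ
  m = suc k

  M : ℚ
  M = toℚ (+ m)

  instance
    M-positive : ℚ.Positive M
    M-positive = ℚ.positive (toℚ-mono-< {+ 0} {+ m} (ℤ.+<+ (s≤s z≤n)))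
    M-nonNegative : ℚ.NonNegative M
    M-nonNegative = ℚP.pos⇒nonNeg M
    M-nonZero : ℚ.NonZero M
    M-nonZero = ℚP.pos⇒nonZero M

  P : ℕ → Point d
  P = p d lam (suc (suc k))

  height-P : ∀ b → height (P b) ≡ + b
  height-P b = begin
    sumℤ d (λ t → + c t) ℤ.- (+ sumℕ d c ℤ.- + b) ≡⟨ cong (λ s → s ℤ.- (+ sumℕ d c ℤ.- + b)) (pos-sumℕ d c) ⟨
    + sumℕ d c ℤ.- (+ sumℕ d c ℤ.- + b)           ≡⟨ solve 2 (λ s b → s :- (s :- b) := b) refl (+ sumℕ d c) (+ b) ⟩
    + b                                           ∎
    where open ≡-Reasoning
          open ℤSolver.+-*-Solver
          c = λ t → ceilDiv (b ℕ.* lam t) m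

  sum-lam-ℚ : sumℚ d (λ t → toℚ (+ lam t)) ≡ M ℚ.+ 1ℚ
  sum-lam-ℚ = begin
    sumℚ d (λ t → toℚ (+ lam t)) ≡⟨ toℚ-sumℤ d (λ t → + lam t) ⟨
    toℚ (sumℤ d (λ t → + lam t)) ≡⟨ cong toℚ (pos-sumℕ d lam) ⟨
    toℚ (+ sumℕ d lam)           ≡⟨ cong (λ s → toℚ (+ s)) (trans sum-lam (ℕP.+-comm 1 m)) ⟩
    toℚ (+ m ℤ.+ + 1)            ≡⟨ toℚ-+ (+ m) (+ 1) ⟩
    M ℚ.+ 1ℚ                     ∎
    where open ≡-Reasoning

  unit-interval-scaled : ∀ γ z → γ ℚ.* M ≡ toℚ z → (0ℚ ℚ.≤ γ × γ ℚ.< 1ℚ) ⇔ (+ 0 ℤ.≤ z × z ℤ.< + m)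
  unit-interval-scaled γ z γM≡z = mk⇔
    (λ (0≤γ , γ<1) →
      toℚ-cancel-≤ (subst₂ ℚ._≤_ (ℚP.*-zeroˡ M) γM≡z (ℚP.*-monoʳ-≤-nonNeg M 0≤γ)) ,
      toℚ-cancel-< (subst₂ ℚ._<_ γM≡z (ℚP.*-identityˡ M) (ℚP.*-monoˡ-<-pos M γ<1)))
    (λ (0≤z , z<m) →
      ℚP.*-cancelʳ-≤-pos M (subst₂ ℚ._≤_ (sym (ℚP.*-zeroˡ M)) (sym γM≡z) (toℚ-mono-≤ 0≤z)) ,
      ℚP.*-cancelʳ-<-nonNeg M (subst₂ ℚ._<_ (sym γM≡z) (sym (ℚP.*-identityˡ M)) (toℚ-mono-< z<m)))

  coordinate-bounds⇔ceilDiv : ∀ {δ γ : ℚ} {b l : ℕ} {x : ℤ} →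
    δ ℚ.* M ≡ toℚ (+ b) → toℚ x ≡ γ ℚ.+ δ ℚ.* toℚ (+ l) →
    (0ℚ ℚ.≤ γ × γ ℚ.< 1ℚ) ⇔ (x ≡ + ceilDiv (b ℕ.* l) m)
  coordinate-bounds⇔ceilDiv {δ} {γ} {b} {l} {x} δM≡b x≡γ+δl =
    ⇔.trans (unit-interval-scaled γ _ γM) (⇔.trans window-shift (window⇔ceilDiv (b ℕ.* l) k x))
    where
    open ≡-Reasoning
    open ℚSolver.+-*-Solver
    γM : γ ℚ.* M ≡ toℚ (x ℤ.* + m ℤ.- + (b ℕ.* l))
    γM = begin
      γ ℚ.* M
        ≡⟨ solve 4 (λ g δ L M → g :* M := ((g :+ δ :* L) :* M) :- (δ :* M) :* L) refl γ δ (toℚ (+ l)) M ⟩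
      (γ ℚ.+ δ ℚ.* toℚ (+ l)) ℚ.* M ℚ.- (δ ℚ.* M) ℚ.* toℚ (+ l)
        ≡⟨ cong₂ (λ u v → u ℚ.* M ℚ.- v ℚ.* toℚ (+ l)) (sym x≡γ+δl) δM≡b ⟩
      toℚ x ℚ.* M ℚ.- toℚ (+ b) ℚ.* toℚ (+ l)      ≡⟨ cong₂ ℚ._-_ (toℚ-* x (+ m)) (toℚ-* (+ b) (+ l)) ⟨
      toℚ (x ℤ.* + m) ℚ.- toℚ (+ b ℤ.* + l)         ≡⟨ toℚ-minus (x ℤ.* + m) (+ b ℤ.* + l) ⟨
      toℚ (x ℤ.* + m ℤ.- + b ℤ.* + l)               ≡⟨ cong (λ u → toℚ (x ℤ.* + m ℤ.- u)) (ℤP.pos-* b l) ⟨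
      toℚ (x ℤ.* + m ℤ.- + (b ℕ.* l))               ∎

  zero-coordinate⇔height : ∀ {x : Point d} {γ : Fin d → ℚ} {δ : ℚ} →
    (∀ t → toℚ (x (suc t)) ≡ γ t ℚ.+ δ ℚ.* toℚ (+ lam t)) →
    (toℚ (x zero) ≡ sumℚ d γ ℚ.+ δ) ⇔ (δ ℚ.* M ≡ toℚ (height x))
  zero-coordinate⇔height {x} {γ} {δ} tails = mk⇔
    (λ x₀≡ → begin
      δ ℚ.* M
        ≡⟨ solve 3 (λ A δ M → δ :* M := (A :+ δ :* (M :+ con 1ℚ)) :- (A :+ δ)) refl A δ M ⟩
      (A ℚ.+ δ ℚ.* (M ℚ.+ 1ℚ)) ℚ.- (A ℚ.+ δ)           ≡⟨ cong₂ ℚ._-_ S≡ x₀≡ ⟨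
      S ℚ.- toℚ (x zero)                               ≡⟨ toℚ-height ⟨
      toℚ (height x)                                   ∎)
    (λ δM≡h → begin
      toℚ (x zero)                                     ≡⟨ solve 2 (λ S x → x := S :- (S :- x)) refl S (toℚ (x zero)) ⟩
      S ℚ.- (S ℚ.- toℚ (x zero))                       ≡⟨ cong₂ ℚ._-_ S≡ (trans (sym toℚ-height) (sym δM≡h)) ⟩
      (A ℚ.+ δ ℚ.* (M ℚ.+ 1ℚ)) ℚ.- δ ℚ.* M
        ≡⟨ solve 3 (λ A δ M → (A :+ δ :* (M :+ con 1ℚ)) :- δ :* M := A :+ δ) refl A δ M ⟩
      A ℚ.+ δ                                          ∎)
    where
    open ≡-Reasoning
    open ℚSolver.+-*-Solver
    A = sumℚ d γ
    S = sumℚ d (λ t → toℚ (x (suc t)))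
    S≡ : S ≡ A ℚ.+ δ ℚ.* (M ℚ.+ 1ℚ)
    S≡ = begin
      S                                                ≡⟨ sumℚ-cong d tails ⟩
      sumℚ d (λ t → γ t ℚ.+ δ ℚ.* toℚ (+ lam t))        ≡⟨ sumℚ-distrib-+ d γ _ ⟩
      A ℚ.+ sumℚ d (λ t → δ ℚ.* toℚ (+ lam t))          ≡⟨ cong (A ℚ.+_) (*-distribˡ-sumℚ d δ _) ⟨
      A ℚ.+ δ ℚ.* sumℚ d (λ t → toℚ (+ lam t))          ≡⟨ cong (λ s → A ℚ.+ δ ℚ.* s) sum-lam-ℚ ⟩
      A ℚ.+ δ ℚ.* (M ℚ.+ 1ℚ)                           ∎
    toℚ-height : toℚ (height x) ≡ S ℚ.- toℚ (x zero)
    toℚ-height = trans (toℚ-minus (sumℤ d (λ t → x (suc t))) (x zero))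
                       (cong (ℚ._- toℚ (x zero)) (toℚ-sumℤ d (λ t → x (suc t))))

  P∈Π : ∀ b → b < m → InΠ d lam (P b)
  P∈Π b b<m = γ , δ , γ-bounds , proj₁ δ-bounds , proj₂ δ-bounds , e₀ , eₜ
    where
    δ : ℚ
    δ = toℚ (+ b) ℚ.* ℚ.1/ M
    δM≡b : δ ℚ.* M ≡ toℚ (+ b)
    δM≡b = trans (ℚP.*-assoc (toℚ (+ b)) (ℚ.1/ M) M)
             (trans (cong (toℚ (+ b) ℚ.*_) (ℚP.*-inverseˡ M)) (ℚP.*-identityʳ (toℚ (+ b))))
    γ : Fin d → ℚ
    γ t = toℚ (P b (suc t)) ℚ.- δ ℚ.* toℚ (+ lam t)
    eₜ : ∀ t → toℚ (P b (suc t)) ≡ γ t ℚ.+ δ ℚ.* toℚ (+ lam t)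
    eₜ t = solve 2 (λ x y → x := (x :- y) :+ y) refl (toℚ (P b (suc t))) (δ ℚ.* toℚ (+ lam t))
      where open ℚSolver.+-*-Solver
    γ-bounds : ∀ t → 0ℚ ℚ.≤ γ t × γ t ℚ.< 1ℚ
    γ-bounds t = Equivalence.from (coordinate-bounds⇔ceilDiv {δ} {γ t} {b} {lam t} δM≡b (eₜ t)) refl
    δ-bounds : 0ℚ ℚ.≤ δ × δ ℚ.< 1ℚ
    δ-bounds = Equivalence.from (unit-interval-scaled δ (+ b) δM≡b) (ℤ.+≤+ z≤n , ℤ.+<+ b<m)
    e₀ : toℚ (P b zero) ≡ sumℚ d γ ℚ.+ δ
    e₀ = Equivalence.from (zero-coordinate⇔height {P b} {γ} {δ} eₜ) (trans δM≡b (cong toℚ (sym (height-P b))))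

  ∈Π⇒≐P : ∀ {x : Point d} → InΠ d lam x → ∃ λ b → b < m × x ≐ P b
  ∈Π⇒≐P {x} (γ , δ , γ-bounds , 0≤δ , δ<1 , e₀ , eₜ) =
    b , ℤP.drop‿+<+ (subst (ℤ._< + m) h≡b (proj₂ h-bounds)) , ≐-by-height tails (trans h≡b (sym (height-P b)))
    where
    δM≡h : δ ℚ.* M ≡ toℚ (height x)
    δM≡h = Equivalence.to (zero-coordinate⇔height {x} {γ} {δ} eₜ) e₀
    h-bounds : + 0 ℤ.≤ height x × height x ℤ.< + m
    h-bounds = Equivalence.to (unit-interval-scaled δ (height x) δM≡h) (0≤δ , δ<1)
    b : ℕ
    b = ℤ.∣ height x ∣
    h≡b : height x ≡ + b
    h≡b = sym (ℤP.0≤i⇒+∣i∣≡i (proj₁ h-bounds))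
    tails : ∀ t → x (suc t) ≡ P b (suc t)
    tails t = Equivalence.to
      (coordinate-bounds⇔ceilDiv {δ} {γ t} {b} {lam t} (trans δM≡h (cong toℚ h≡b)) (eₜ t)) (γ-bounds t)

  ⊖≐P⇒≡+ : ∀ i j b → (P j ⊖ P i) ≐ P b → j ≡ i ℕ.+ b
  ⊖≐P⇒≡+ i j b Pj⊖Pi≐Pb = pos-difference (begin
    + b                           ≡⟨ height-P b ⟨
    height (P b)                  ≡⟨ height-cong {x = P j ⊖ P i} {P b} Pj⊖Pi≐Pb ⟨
    height (P j ⊖ P i)            ≡⟨ height-⊖ (P j) (P i) ⟩
    height (P j) ℤ.- height (P i) ≡⟨ cong₂ ℤ._-_ (height-P j) (height-P i) ⟩
    + j ℤ.- + i                   ∎)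
    where open ≡-Reasoning

lemma2p13 : (n d : ℕ) (lam : Fin d → ℕ) →
    2 ≤ n → ((t : Fin d) → 1 ≤ lam t) → sumℕ d lam ≡ n →
    (i j : ℕ) → i < n ∸ 1 → j < n ∸ 1 → ¬ (i ≡ j) →
    (p d lam n i ⪯[ lam ] p d lam n j) ⇔
      ((i < j) × ((p d lam n i ⊕ p d lam n (j ∸ i)) ≐ p d lam n j))
lemma2p13 (suc (suc k)) d lam _ _ sum-lam i j _ j<m i≢j = mk⇔ forward backward
  where
  open LatticePoints d lam k sum-lam
  forward : InΠ d lam (P j ⊖ P i) → (i < j) × ((P i ⊕ P (j ∸ i)) ≐ P j)
  forward Pj⊖Pi∈Π =
    let (b , _ , Pj⊖Pi≐Pb) = ∈Π⇒≐P {P j ⊖ P i} Pj⊖Pi∈Π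
        j≡i+b = ⊖≐P⇒≡+ i j b Pj⊖Pi≐Pb
        b≡j∸i = trans (sym (ℕP.m+n∸m≡n i b)) (cong (_∸ i) (sym j≡i+b))
    in ℕP.≤∧≢⇒< (subst (i ≤_) (sym j≡i+b) (ℕP.m≤m+n i b)) i≢j ,
       Equivalence.from (⊕-≐⇔⊖-≐ {x = P i} {P (j ∸ i)} {P j})
         (subst (λ e → (P j ⊖ P i) ≐ P e) b≡j∸i Pj⊖Pi≐Pb)
  backward : (i < j) × ((P i ⊕ P (j ∸ i)) ≐ P j) → InΠ d lam (P j ⊖ P i)
  backward (_ , Pi⊕P[j∸i]≐Pj) =
    InΠ-resp-≐ {d} {lam} {P (j ∸ i)} {P j ⊖ P i}
      (λ q → sym (Equivalence.to (⊕-≐⇔⊖-≐ {x = P i} {P (j ∸ i)} {P j}) Pi⊕P[j∸i]≐Pj q))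
      (P∈Π (j ∸ i) (ℕP.≤-<-trans (ℕP.m∸n≤m j i) j<m))
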